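{- Let $T=(T_1,T_2)$ be a rooted binary tree with $n \geq 2$ leaves, where $T_1$ and $T_2$ have $n_1$ and $n_2$ leaves respectively. If $T$ has maximum stairs2 index among all rooted binary trees with $n$ leaves, then $T_1$ has maximum stairs2 index among all rooted binary trees with $n_1$ leaves and $T_2$ has maximum stairs2 index among all rooted binary trees with $n_2$ leaves.
   Context: A rooted binary tree is a rooted tree (directed, unique root $\rho$ of in-degree zero, unique directed path from $\rho$ to every vertex) in which every non-leaf (inner) vertex has exactly two children; trees are considered up to isomorphism, a tree with one leaf is a single vertex. For $n\ge2$, $T=(T_1,T_2)$ means $T_1,T_2$ are the subtrees pending at the two children of the root. For a vertex $v$, $n_v$ is the number of leaves among $v$ and its descendants. The stairs2 index of a rooted binary tree $T$ with $n$ leaves is $st_2(T)=0$ if $n\in\{0,1\}$, and for $n\ge 2$ $$st_2(T)=\frac{1}{n-1}\sum_{v \text{ inner vertex of } T}\frac{\min\{n_{v_1},n_{v_2}\}}{\max\{n_{v_1},n_{v_2}\}},$$ where $v_1,v_2$ are the two children of $v$. -}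

module Defs where

open import Data.Nat using (ℕ; zero; suc; _+_; _⊓_; _⊔_)
open import Data.Integer using (+_)
open import Data.Rational using (ℚ; 0ℚ; _/_; _*_; _≤_) renaming (_+_ to _+ℚ_)
open import Data.Product using (_×_)
open import Relation.Binary.PropositionalEquality using (_≡_)

-- Rooted binary trees (up to isomorphism, every tree is represented;
-- all notions below are isomorphism invariant).
data BinTree : Set where
  leaf : BinTree
  node : BinTree → BinTree → BinTree

leaves : BinTree → ℕ
leaves leaf       = 1
leaves (node l r) = leaves l + leaves r

inner : BinTree → ℕ
inner leaf       = 0
inner (node l r) = suc (inner l + inner r)

-- min{n_{v1},n_{v2}} / max{n_{v1},n_{v2}} at an inner vertex with children
-- subtrees l r; max ≥ 1, written as suc (pred max) to make NonZero evident
balRatio : BinTree → BinTree → ℚ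
balRatio l r = (+ (leaves l ⊓ leaves r)) / suc (inner l ⊔ inner r)

ratioSum : BinTree → ℚ
ratioSum leaf       = 0ℚ
ratioSum (node l r) = balRatio l r +ℚ (ratioSum l +ℚ ratioSum r)

st2 : BinTree → ℚ
st2 leaf           = 0ℚ
st2 t@(node l r)   = ratioSum t * ((+ 1) / inner t)

IsSt2Max : ℕ → BinTree → Set
IsSt2Max n T = (leaves T ≡ n) × (∀ (T' : BinTree) → leaves T' ≡ n → st2 T' ≤ st2 T)

-- Replacing a root subtree of T by another tree with the same number of leaves
-- changes neither the balance ratio at the root nor the normalising factor
-- n - 1, so st2 T moves exactly as the ratio sum of that subtree does. Among
-- trees with a fixed number of leaves st2 is a positive multiple of the ratio
-- sum, hence a subtree with larger st2 would yield a tree T with larger st2.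
module Submission where

open import Defs
open import Data.Nat as ℕ using (ℕ; suc; _≥_)
import Data.Nat.Properties as ℕ
open import Data.Integer using (+_)
open import Data.Rational using (_/_; _*_; _≤_; -_) renaming (_+_ to _+ℚ_)
open import Data.Rational.Properties
open import Algebra.Properties.Group +-0-group using (\\-leftDividesʳ)
open import Data.Empty using (⊥-elim)
open import Data.Product using (_×_; _,_)
open import Function.Base using (_∘_)
open import Function.Bundles using (_⇔_; mk⇔; module Equivalence)
open import Relation.Binary.PropositionalEquality

leaves≡1+inner : ∀ t → leaves t ≡ suc (inner t)
leaves≡1+inner leaf       = refl
leaves≡1+inner (node l r) = begin
  leaves l ℕ.+ leaves r           ≡⟨ cong₂ ℕ._+_ (leaves≡1+inner l) (leaves≡1+inner r) ⟩
  suc (inner l) ℕ.+ suc (inner r) ≡⟨ cong suc (ℕ.+-suc (inner l) (inner r)) ⟩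
  suc (suc (inner l ℕ.+ inner r)) ∎
  where open ≡-Reasoning

inner-cong : ∀ s t → leaves s ≡ leaves t → inner s ≡ inner t
inner-cong s t e =
  ℕ.suc-injective (trans (sym (leaves≡1+inner s)) (trans e (leaves≡1+inner t)))

+-cancelˡ-≤ : ∀ r {p q} → r +ℚ p ≤ r +ℚ q → p ≤ q
+-cancelˡ-≤ r {p} {q} r+p≤r+q = begin
  p               ≡⟨ sym (\\-leftDividesʳ r p) ⟩
  - r +ℚ (r +ℚ p) ≤⟨ +-monoʳ-≤ (- r) r+p≤r+q ⟩
  - r +ℚ (r +ℚ q) ≡⟨ \\-leftDividesʳ r q ⟩
  q               ∎
  where open ≤-Reasoning

+-cancelʳ-≤ : ∀ r {p q} → p +ℚ r ≤ q +ℚ r → p ≤ q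
+-cancelʳ-≤ r {p} {q} = +-cancelˡ-≤ r ∘ subst₂ _≤_ (+-comm p r) (+-comm q r)

*-1/suc-≤⇔ : ∀ k {p q} → p * ((+ 1) / suc k) ≤ q * ((+ 1) / suc k) ⇔ p ≤ q
*-1/suc-≤⇔ k = mk⇔ (*-cancelʳ-≤-pos 1/k+1) (*-monoʳ-≤-nonNeg 1/k+1)
  where
  1/k+1 = (+ 1) / suc k
  instance
    1/k+1-pos = normalize-pos 1 (suc k)
    1/k+1-nonNeg = pos⇒nonNeg 1/k+1

st2-≤⇔ratioSum-≤ : ∀ s t → leaves s ≡ leaves t → st2 s ≤ st2 t ⇔ ratioSum s ≤ ratioSum t
st2-≤⇔ratioSum-≤ leaf         leaf         _ = mk⇔ (λ _ → ≤-refl) (λ _ → ≤-refl)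
st2-≤⇔ratioSum-≤ leaf         t@(node _ _) e = ⊥-elim (ℕ.0≢1+n (inner-cong leaf t e))
st2-≤⇔ratioSum-≤ s@(node _ _) leaf         e = ⊥-elim (ℕ.0≢1+n (inner-cong leaf s (sym e)))
st2-≤⇔ratioSum-≤ s@(node _ _) t@(node _ _) e = scale (ℕ.suc-injective (inner-cong s t e))
  where
  scale : ∀ {i j p q} → i ≡ j → p * ((+ 1) / suc i) ≤ q * ((+ 1) / suc j) ⇔ p ≤ q
  scale {i} refl = *-1/suc-≤⇔ i

balRatio-congˡ : ∀ l′ l r → leaves l′ ≡ leaves l → balRatio l′ r ≡ balRatio l r
balRatio-congˡ l′ l r e =
  cong₂ (λ m k → (+ m) / suc k) (cong (ℕ._⊓ leaves r) e) (cong (ℕ._⊔ inner r) (inner-cong l′ l e))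

balRatio-comm : ∀ l r → balRatio l r ≡ balRatio r l
balRatio-comm l r =
  cong₂ (λ m k → (+ m) / suc k) (ℕ.⊓-comm (leaves l) (leaves r)) (ℕ.⊔-comm (inner l) (inner r))

st2-node-comm : ∀ l r → st2 (node l r) ≡ st2 (node r l)
st2-node-comm l r = cong₂ (λ x k → x * ((+ 1) / suc k))
  (cong₂ _+ℚ_ (balRatio-comm l r) (+-comm (ratioSum l) (ratioSum r)))
  (ℕ.+-comm (inner l) (inner r))

ratioSum-node-cancelˡ-≤ : ∀ l′ l r → leaves l′ ≡ leaves l →
  ratioSum (node l′ r) ≤ ratioSum (node l r) → ratioSum l′ ≤ ratioSum l
ratioSum-node-cancelˡ-≤ l′ l r e =
  +-cancelʳ-≤ (ratioSum r) ∘ +-cancelˡ-≤ (balRatio l r)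
  ∘ subst (λ b → b +ℚ (ratioSum l′ +ℚ ratioSum r) ≤ ratioSum (node l r)) (balRatio-congˡ l′ l r e)

st2-node-cancelˡ-≤ : ∀ l′ l r → leaves l′ ≡ leaves l →
  st2 (node l′ r) ≤ st2 (node l r) → st2 l′ ≤ st2 l
st2-node-cancelˡ-≤ l′ l r e =
  Equivalence.from (st2-≤⇔ratioSum-≤ l′ l e)
  ∘ ratioSum-node-cancelˡ-≤ l′ l r e
  ∘ Equivalence.to (st2-≤⇔ratioSum-≤ (node l′ r) (node l r) (cong (ℕ._+ leaves r) e))

st2-node-cancelʳ-≤ : ∀ l r′ r → leaves r′ ≡ leaves r →
  st2 (node l r′) ≤ st2 (node l r) → st2 r′ ≤ st2 r
st2-node-cancelʳ-≤ l r′ r e =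
  st2-node-cancelˡ-≤ r′ r l e ∘ subst₂ _≤_ (st2-node-comm l r′) (st2-node-comm l r)

-- The hypothesis n ≥ 2 is automatic for a tree of the form node T₁ T₂.
lemma4p2 : (n : ℕ) → (T₁ T₂ : BinTree) → leaves (node T₁ T₂) ≡ n → n ≥ 2 →
           IsSt2Max n (node T₁ T₂) →
           IsSt2Max (leaves T₁) T₁ × IsSt2Max (leaves T₂) T₂
lemma4p2 _ T₁ T₂ refl _ (_ , maximal) =
  (refl , λ T e → st2-node-cancelˡ-≤ T T₁ T₂ e (maximal (node T T₂) (cong (ℕ._+ leaves T₂) e))) ,
  (refl , λ T e → st2-node-cancelʳ-≤ T₁ T T₂ e (maximal (node T₁ T) (cong (leaves T₁ ℕ.+_) e)))
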